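{- No inter-nut digraph contains a cut-arc.
   Context: A digraph $G$ is a finite nonempty vertex set $V(G)$ with an arbitrary binary relation $\to$. $\operatorname{Ker}G=\{\mathbf{x}\colon V(G)\to\mathbb{R} : \sum_{w: z\to w}\mathbf{x}(w)=0\ \forall z\}$ and $\operatorname{CoKer}G=\{\mathbf{x} : \sum_{w:w\to z}\mathbf{x}(w)=0\ \forall z\}$. A vector is full if it has no zero entry. $G$ is inter-nut if $\operatorname{Ker}G\cap\operatorname{CoKer}G$ is one-dimensional and spanned by a full vector. The underlying graph of $G$ is the simple graph on $V(G)$ where distinct $u,v$ are adjacent iff $u\to v$ or $v\to u$; $G$ is connected if its underlying graph is. A cut-arc of a connected digraph is an arc whose removal leaves a disconnected digraph.
   Formalization: The vectors in $\operatorname{Ker}G\cap\operatorname{CoKer}G$ that define inter-nut digraphs, and the scalars spanning it, are rational rather than real. -}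

module Defs where

open import Data.Nat using (ℕ; zero; suc)
open import Data.Fin using (Fin; zero; suc; _≟_)
open import Data.Bool using (Bool; true; false; if_then_else_; _∧_; not)
open import Data.Rational using (ℚ; 0ℚ; _+_; _*_)
open import Data.Product using (Σ; _×_; _,_; ∃)
open import Data.Sum using (_⊎_)
open import Relation.Binary.PropositionalEquality using (_≡_; _≢_)
open import Relation.Binary.Construct.Closure.ReflexiveTransitive using (Star)
open import Relation.Nullary.Decidable using (⌊_⌋)
open import Relation.Nullary using (¬_)

-- A digraph on n vertices: vertex set Fin n, an arbitrary binary relation
-- (loops allowed), given by its 0/1 adjacency (z → w iff A z w ≡ true).
Digraph : ℕ → Set
Digraph n = Fin n → Fin n → Bool

sumFin : ∀ n → (Fin n → ℚ) → ℚ
sumFin zero    f = 0ℚ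
sumFin (suc n) f = f zero + sumFin n (λ i → f (suc i))

Vector : ℕ → Set
Vector n = Fin n → ℚ

InKer : ∀ {n} → Digraph n → Vector n → Set
InKer {n} A x = ∀ z → sumFin n (λ w → if A z w then x w else 0ℚ) ≡ 0ℚ

InCoKer : ∀ {n} → Digraph n → Vector n → Set
InCoKer {n} A x = ∀ z → sumFin n (λ w → if A w z then x w else 0ℚ) ≡ 0ℚ

InKerCoKer : ∀ {n} → Digraph n → Vector n → Set
InKerCoKer A x = InKer A x × InCoKer A x

Full : ∀ {n} → Vector n → Set
Full x = ∀ i → x i ≢ 0ℚ

InterNut : ∀ {n} → Digraph n → Set
InterNut {n} A =
  Σ (Vector n) λ x → Full x × InKerCoKer A x ×
    (∀ y → InKerCoKer A y → ∃ λ (c : ℚ) → ∀ i → y i ≡ c * x i)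

UAdj : ∀ {n} → Digraph n → Fin n → Fin n → Set
UAdj A u v = u ≢ v × (A u v ≡ true ⊎ A v u ≡ true)

Connected : ∀ {n} → Digraph n → Set
Connected A = ∀ u v → Star (UAdj A) u v

removeArc : ∀ {n} → Digraph n → Fin n → Fin n → Digraph n
removeArc A u v x y = A x y ∧ not (⌊ x ≟ u ⌋ ∧ ⌊ y ≟ v ⌋)

IsCutArc : ∀ {n} → Digraph n → Fin n → Fin n → Set
IsCutArc A u v = A u v ≡ true × ¬ Connected (removeArc A u v)

{-# OPTIONS --safe #-}
-- Let x be a full vector of Ker G ∩ CoKer G and u → v a cut-arc, and let y be x
-- restricted to the vertices reachable from u in G − (u → v); v is not among them.
-- For the form ⟨f, g⟩ = Σ_{w → z} f(w) g(z), the kernel condition gives ⟨y, x⟩ = 0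
-- and the cokernel condition ⟨x, y⟩ = 0. As u → v is the only arc between the
-- reachable set and its complement, ⟨y, x⟩ = ⟨y, y⟩′ + x(u) x(v) and ⟨x, y⟩ = ⟨y, y⟩′,
-- where ⟨_,_⟩′ sums over the arcs of G − (u → v). Hence x(u) x(v) = 0, contradicting
-- fullness.
module Submission where

open import Defs
open import Data.Nat using (ℕ; suc)
open import Data.Fin using (Fin)
open import Relation.Nullary using (¬_)

import Data.Nat as ℕ
import Data.Fin as Fin
open import Data.Fin using (_≟_)
open import Data.Fin.Properties using (punchInᵢ≢i; sequence)
open import Data.Bool using (Bool; true; false; if_then_else_; _∧_; not)
open import Data.Rational using (ℚ; 0ℚ; 1ℚ; _+_; _*_; 1/_; ≢-nonZero)
open import Data.Rational.Properties
  using (+-*-ring; +-identityˡ; +-identityʳ; *-identityˡ; *-zeroˡ; *-zeroʳ;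
         *-comm; *-assoc; *-inverseˡ)
open import Algebra.Bundles using (Ring)
open import Algebra.Properties.Semiring.Sum (Ring.semiring +-*-ring)
  using (sum; sum-syntax; sum-cong-≗; sum-replicate-zero; sum-remove;
         ∑-distrib-+; ∑-comm; *-distribˡ-sum)
open import Data.Product using (_×_; _,_; proj₁; proj₂)
open import Data.Sum using (inj₁; inj₂; swap)
open import Function using (_∘_)
open import Effect.Monad using (RawMonad)
open import Relation.Binary.Core using (_⇒_)
open import Relation.Binary.Definitions using (Sym)
open import Relation.Binary.PropositionalEquality
  using (_≡_; _≢_; refl; sym; trans; cong; cong₂; ≢-sym; module ≡-Reasoning)
open import Relation.Binary.Construct.Closure.ReflexiveTransitive
  using (Star; ε; _◅◅_; return; reverse; _⋆)
open import Relation.Nullary using (Dec; yes; no; does)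
open import Relation.Nullary.Decidable
  using (⌊_⌋; isYes≗does; dec-true; dec-false; ¬¬-excluded-middle)
open import Relation.Nullary.Negation using (¬¬-Monad; contradiction)

open ≡-Reasoning

*-≢0 : ∀ {p q} → p ≢ 0ℚ → q ≢ 0ℚ → p * q ≢ 0ℚ
*-≢0 {p} {q} p≢0 q≢0 pq≡0 = q≢0 (begin
  q               ≡⟨ sym (*-identityˡ q) ⟩
  1ℚ * q          ≡⟨ cong (_* q) (sym (*-inverseˡ p)) ⟩
  (1/ p * p) * q  ≡⟨ *-assoc (1/ p) p q ⟩
  1/ p * (p * q)  ≡⟨ cong (1/ p *_) pq≡0 ⟩
  1/ p * 0ℚ       ≡⟨ *-zeroʳ (1/ p) ⟩
  0ℚ              ∎)
  where instance _ = ≢-nonZero p≢0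

if-*ˡ : ∀ c b x → (if b then c * x else 0ℚ) ≡ c * (if b then x else 0ℚ)
if-*ˡ c true  x = refl
if-*ˡ c false x = sym (*-zeroʳ c)

if-split-∧-not : ∀ {a} d (t : ℚ) → (d ≡ true → a ≡ true) →
  (if a then t else 0ℚ) ≡ (if a ∧ not d then t else 0ℚ) + (if d then t else 0ℚ)
if-split-∧-not {true}  true  t _ = sym (+-identityˡ t)
if-split-∧-not {true}  false t _ = sym (+-identityʳ t)
if-split-∧-not {false} true  t d⇒a with () ← d⇒a refl
if-split-∧-not {false} false t _ = sym (+-identityʳ 0ℚ)

sumFin≡sum : ∀ n (f : Vector n) → sumFin n f ≡ sum f
sumFin≡sum ℕ.zero  f = refl
sumFin≡sum (suc n) f = cong (f Fin.zero +_) (sumFin≡sum n (f ∘ Fin.suc))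

sum-zero : ∀ {n} {f : Vector n} → (∀ i → f i ≡ 0ℚ) → sum f ≡ 0ℚ
sum-zero {n} f≗0 = trans (sum-cong-≗ f≗0) (sum-replicate-zero n)

sum-if-*ˡ : ∀ {n} c (b : Fin n → Bool) (g : Vector n) →
  ∑[ i < n ] (if b i then c * g i else 0ℚ) ≡ c * ∑[ i < n ] (if b i then g i else 0ℚ)
sum-if-*ˡ c b g = trans (sum-cong-≗ (λ i → if-*ˡ c (b i) (g i)))
                        (sym (*-distribˡ-sum c (λ i → if b i then g i else 0ℚ)))

sum-if-∧ : ∀ {n} b (c : Fin n → Bool) (g : Vector n) →
  ∑[ i < n ] (if b ∧ c i then g i else 0ℚ) ≡
  (if b then ∑[ i < n ] (if c i then g i else 0ℚ) else 0ℚ)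
sum-if-∧     true  c g = refl
sum-if-∧ {n} false c g = sum-zero {n} (λ _ → refl)

sum-if-≟ : ∀ {n} (j : Fin n) (g : Vector n) →
  ∑[ i < n ] (if ⌊ i ≟ j ⌋ then g i else 0ℚ) ≡ g j
sum-if-≟ {suc n} j g = begin
  sum indicator
    ≡⟨ sum-remove {i = j} indicator ⟩
  indicator j + sum (indicator ∘ Fin.punchIn j)
    ≡⟨ cong₂ _+_ indicator-j (sum-zero indicator-punchIn) ⟩
  g j + 0ℚ
    ≡⟨ +-identityʳ (g j) ⟩
  g j
    ∎
  where
  indicator : Vector (suc n)
  indicator i = if ⌊ i ≟ j ⌋ then g i else 0ℚ
  indicator-j : indicator j ≡ g j
  indicator-j = cong (λ b → if b then g j else 0ℚ)
    (trans (isYes≗does (j ≟ j)) (dec-true (j ≟ j) refl))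
  indicator-punchIn : ∀ i → indicator (Fin.punchIn j i) ≡ 0ℚ
  indicator-punchIn i = cong (λ b → if b then g (Fin.punchIn j i) else 0ℚ)
    (trans (isYes≗does (Fin.punchIn j i ≟ j)) (dec-false (Fin.punchIn j i ≟ j) (punchInᵢ≢i j i)))

arcSum : ∀ {n} → Digraph n → Vector n → Vector n → ℚ
arcSum {n} A f g = ∑[ w < n ] ∑[ z < n ] (if A w z then f w * g z else 0ℚ)

module _ {n} (A : Digraph n) where

  arcSum-cong : ∀ (f g f′ g′ : Vector n) → (∀ w z → A w z ≡ true → f w * g z ≡ f′ w * g′ z) →
    arcSum A f g ≡ arcSum A f′ g′
  arcSum-cong f g f′ g′ eq = sum-cong-≗ λ w → sum-cong-≗ λ z → term w z (A w z) refl
    where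
    term : ∀ w z b → A w z ≡ b → (if b then f w * g z else 0ℚ) ≡ (if b then f′ w * g′ z else 0ℚ)
    term w z true  arc = eq w z arc
    term w z false _   = refl

  arcSum-ker : ∀ {g} → InKer A g → ∀ f → arcSum A f g ≡ 0ℚ
  arcSum-ker {g} ker f = sum-zero λ w → begin
    ∑[ z < n ] (if A w z then f w * g z else 0ℚ)  ≡⟨ sum-if-*ˡ (f w) (A w) g ⟩
    f w * ∑[ z < n ] (if A w z then g z else 0ℚ)  ≡⟨ cong (f w *_) (out-sum w) ⟩
    f w * 0ℚ                                       ≡⟨ *-zeroʳ (f w) ⟩
    0ℚ                                             ∎
    where
    out-sum : ∀ w → ∑[ z < n ] (if A w z then g z else 0ℚ) ≡ 0ℚ
    out-sum w = trans (sym (sumFin≡sum n _)) (ker w)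

  arcSum-coker : ∀ {f} → InCoKer A f → ∀ g → arcSum A f g ≡ 0ℚ
  arcSum-coker {f} coker g =
    trans (∑-comm (λ w z → if A w z then f w * g z else 0ℚ)) (sum-zero λ z → begin
      ∑[ w < n ] (if A w z then f w * g z else 0ℚ)
        ≡⟨ sum-cong-≗ (λ w → cong (λ t → if A w z then t else 0ℚ) (*-comm (f w) (g z))) ⟩
      ∑[ w < n ] (if A w z then g z * f w else 0ℚ)
        ≡⟨ sum-if-*ˡ (g z) (λ w → A w z) f ⟩
      g z * ∑[ w < n ] (if A w z then f w else 0ℚ)
        ≡⟨ cong (g z *_) (in-sum z) ⟩
      g z * 0ℚ
        ≡⟨ *-zeroʳ (g z) ⟩
      0ℚ
        ∎)
    where
    in-sum : ∀ z → ∑[ w < n ] (if A w z then f w else 0ℚ) ≡ 0ℚ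
    in-sum z = trans (sym (sumFin≡sum n _)) (coker z)

  arcSum-removeArc : ∀ {u v} → A u v ≡ true → ∀ f g →
    arcSum A f g ≡ arcSum (removeArc A u v) f g + f u * g v
  arcSum-removeArc {u} {v} arc f g = begin
    arcSum A f g
      ≡⟨ sum-cong-≗ split-row ⟩
    ∑[ w < n ] (∑[ z < n ] term A′ w z + ∑[ z < n ] term isUV w z)
      ≡⟨ ∑-distrib-+ (λ w → ∑[ z < n ] term A′ w z) (λ w → ∑[ z < n ] term isUV w z) ⟩
    arcSum A′ f g + ∑[ w < n ] ∑[ z < n ] term isUV w z
      ≡⟨ cong (arcSum A′ f g +_) arcSum-isUV ⟩
    arcSum A′ f g + f u * g v
      ∎
    where
    A′ isUV : Digraph n
    A′ = removeArc A u v
    isUV w z = ⌊ w ≟ u ⌋ ∧ ⌊ z ≟ v ⌋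
    isUV⇒arc : ∀ w z → isUV w z ≡ true → A w z ≡ true
    isUV⇒arc w z with w ≟ u | z ≟ v
    ... | yes refl | yes refl = λ _ → arc
    ... | yes _    | no _     = λ ()
    ... | no _     | _        = λ ()
    term : Digraph n → Fin n → Fin n → ℚ
    term B w z = if B w z then f w * g z else 0ℚ
    split-row : ∀ w → ∑[ z < n ] term A w z ≡ ∑[ z < n ] term A′ w z + ∑[ z < n ] term isUV w z
    split-row w = trans (sum-cong-≗ (λ z → if-split-∧-not (isUV w z) (f w * g z) (isUV⇒arc w z)))
                        (∑-distrib-+ (term A′ w) (term isUV w))
    row-isUV : ∀ w → ∑[ z < n ] term isUV w z ≡ (if ⌊ w ≟ u ⌋ then f w * g v else 0ℚ)
    row-isUV w = begin
      ∑[ z < n ] term isUV w z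
        ≡⟨ sum-if-∧ ⌊ w ≟ u ⌋ (λ z → ⌊ z ≟ v ⌋) (λ z → f w * g z) ⟩
      (if ⌊ w ≟ u ⌋ then ∑[ z < n ] (if ⌊ z ≟ v ⌋ then f w * g z else 0ℚ) else 0ℚ)
        ≡⟨ cong (λ t → if ⌊ w ≟ u ⌋ then t else 0ℚ) (sum-if-≟ v (λ z → f w * g z)) ⟩
      (if ⌊ w ≟ u ⌋ then f w * g v else 0ℚ)
        ∎
    arcSum-isUV : ∑[ w < n ] ∑[ z < n ] term isUV w z ≡ f u * g v
    arcSum-isUV = trans (sum-cong-≗ row-isUV) (sum-if-≟ u (λ w → f w * g v))

restrict : ∀ {n} → (Fin n → Bool) → Vector n → Vector n
restrict c x i = if c i then x i else 0ℚ

ConstantOnArcs : ∀ {n} → Digraph n → (Fin n → Bool) → Set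
ConstantOnArcs {n} A c = ∀ (w z : Fin n) → A w z ≡ true → c w ≡ c z

if-*ˡ-restrict : ∀ {b b′} → b ≡ b′ → ∀ p q →
  (if b then p else 0ℚ) * q ≡ (if b then p else 0ℚ) * (if b′ then q else 0ℚ)
if-*ˡ-restrict {true}  refl p q = refl
if-*ˡ-restrict {false} refl p q = trans (*-zeroˡ q) (sym (*-zeroˡ 0ℚ))

if-*ʳ-restrict : ∀ {b b′} → b ≡ b′ → ∀ p q →
  p * (if b′ then q else 0ℚ) ≡ (if b then p else 0ℚ) * (if b′ then q else 0ℚ)
if-*ʳ-restrict {true}  refl p q = refl
if-*ʳ-restrict {false} refl p q = trans (*-zeroʳ p) (sym (*-zeroˡ 0ℚ))

module _ {n} (A : Digraph n) {c : Fin n → Bool} (constant : ConstantOnArcs A c) (x : Vector n) where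

  arcSum-restrictˡ : arcSum A (restrict c x) x ≡ arcSum A (restrict c x) (restrict c x)
  arcSum-restrictˡ = arcSum-cong A (restrict c x) x (restrict c x) (restrict c x)
    (λ w z arc → if-*ˡ-restrict (constant w z arc) (x w) (x z))

  arcSum-restrictʳ : arcSum A x (restrict c x) ≡ arcSum A (restrict c x) (restrict c x)
  arcSum-restrictʳ = arcSum-cong A x (restrict c x) (restrict c x) (restrict c x)
    (λ w z arc → if-*ʳ-restrict (constant w z arc) (x w) (x z))

InKerCoKer-cut-arc : ∀ {n} (A : Digraph n) (x : Vector n) → InKerCoKer A x →
  ∀ {u v} → A u v ≡ true → ∀ c → ConstantOnArcs (removeArc A u v) c → c u ≡ true → c v ≡ false →
  x u * x v ≡ 0ℚ
InKerCoKer-cut-arc A x (ker , coker) {u} {v} arc c constant cu cv = begin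
  x u * x v                  ≡⟨ sym (+-identityˡ (x u * x v)) ⟩
  0ℚ + x u * x v             ≡⟨ cong₂ _+_ (sym inside≡0) (cong (_* x v) (sym yu≡xu)) ⟩
  inside + y u * x v         ≡⟨ cong (_+ y u * x v) (sym (arcSum-restrictˡ A′ constant x)) ⟩
  arcSum A′ y x + y u * x v  ≡⟨ sym (arcSum-removeArc A arc y x) ⟩
  arcSum A y x               ≡⟨ arcSum-ker A ker y ⟩
  0ℚ                         ∎
  where
  A′ = removeArc A u v
  y = restrict c x
  inside = arcSum A′ y y
  yu≡xu : y u ≡ x u
  yu≡xu = cong (λ b → if b then x u else 0ℚ) cu
  xu*yv≡0 : x u * y v ≡ 0ℚ
  xu*yv≡0 = trans (cong (λ b → x u * (if b then x v else 0ℚ)) cv) (*-zeroʳ (x u))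
  inside≡0 : inside ≡ 0ℚ
  inside≡0 = begin
    inside                     ≡⟨ sym (+-identityʳ inside) ⟩
    inside + 0ℚ                ≡⟨ cong (inside +_) (sym xu*yv≡0) ⟩
    inside + x u * y v         ≡⟨ cong (_+ x u * y v) (sym (arcSum-restrictʳ A′ constant x)) ⟩
    arcSum A′ x y + x u * y v  ≡⟨ sym (arcSum-removeArc A arc x y) ⟩
    arcSum A x y               ≡⟨ arcSum-coker A coker y ⟩
    0ℚ                         ∎

UAdj-sym : ∀ {n} (A : Digraph n) → Sym (UAdj A) (UAdj A)
UAdj-sym A (w≢z , arc) = ≢-sym w≢z , swap arc

arc⇒walk : ∀ {n} (A : Digraph n) {w z} → A w z ≡ true → Star (UAdj A) w z
arc⇒walk A {w} {z} arc with w ≟ z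
... | yes refl = ε
... | no w≢z   = return (w≢z , inj₁ arc)

reachable-constantOnArcs : ∀ {n} (A : Digraph n) {s} (reach? : ∀ z → Dec (Star (UAdj A) s z)) →
  ConstantOnArcs A (λ z → does (reach? z))
reachable-constantOnArcs A reach? w z arc with reach? w | reach? z
... | yes _   | yes _   = refl
... | no _    | no _    = refl
... | yes s⇝w | no s↛z  = contradiction (s⇝w ◅◅ arc⇒walk A arc) s↛z
... | no s↛w  | yes s⇝z = contradiction (s⇝z ◅◅ reverse (UAdj-sym A) (arc⇒walk A arc)) s↛w

removeArc-true : ∀ {n} (A : Digraph n) {u v p q} → A p q ≡ true → ¬ (p ≡ u × q ≡ v) →
  removeArc A u v p q ≡ true
removeArc-true A {u} {v} {p} {q} arc ¬uv rewrite arc with p ≟ u | q ≟ v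
... | yes refl | yes refl = contradiction (refl , refl) ¬uv
... | yes _    | no _     = refl
... | no _     | _        = refl

module _ {n} (A : Digraph n) {u v : Fin n} (u⇝v : Star (UAdj (removeArc A u v)) u v) where

  arc⇒removeArc-walk : ∀ {p q} → A p q ≡ true → Star (UAdj (removeArc A u v)) p q
  arc⇒removeArc-walk {p} {q} arc with p ≟ u | q ≟ v
  ... | yes refl | yes refl = u⇝v
  ... | no p≢u   | _        = arc⇒walk (removeArc A u v) (removeArc-true A arc (p≢u ∘ proj₁))
  ... | yes _    | no q≢v   = arc⇒walk (removeArc A u v) (removeArc-true A arc (q≢v ∘ proj₂))

  removeArc-connected : Connected A → Connected (removeArc A u v)
  removeArc-connected connected a b = (step ⋆) (connected a b)
    where
    step : UAdj A ⇒ Star (UAdj (removeArc A u v))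
    step (_ , inj₁ arc) = arc⇒removeArc-walk arc
    step (_ , inj₂ arc) = reverse (UAdj-sym (removeArc A u v)) (arc⇒removeArc-walk arc)

proposition27 : ∀ (n : ℕ) (A : Digraph (suc n)) → InterNut A → Connected A →
    ∀ (u v : Fin (suc n)) → ¬ IsCutArc A u v
proposition27 n A (x , full , kerCoKer , _) connected u v (arc , disconnected) =
  ¬¬-reachable? λ reach? →
    *-≢0 (full u) (full v)
      (InKerCoKer-cut-arc A x kerCoKer arc (λ z → does (reach? z))
        (reachable-constantOnArcs (removeArc A u v) reach?)
        (dec-true (reach? u) ε)
        (dec-false (reach? v) (λ u⇝v → disconnected (removeArc-connected A u⇝v connected))))
  where
  -- The goal is ⊥, so excluded middle for each vertex, in double-negated form, suffices.
  ¬¬-reachable? : ¬ ¬ (∀ z → Dec (Star (UAdj (removeArc A u v)) u z))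
  ¬¬-reachable? = sequence (RawMonad.rawApplicative ¬¬-Monad) (λ _ → ¬¬-excluded-middle)
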